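{- Let $B$ be an integral base-polyhedron in $\mathbb{R}^S$ and $\Phi:\mathbb{Z}^S\to\mathbb{R}$ a symmetric convex function. Then each decreasingly minimal element of $B\cap\mathbb{Z}^S$ is a minimizer of $\Phi$ over $B\cap\mathbb{Z}^S$.
   Context: $S=\{1,\dots,n\}$. An integral base-polyhedron is $B=B'(p)=\{x\in\mathbb{R}^S:\widetilde x(S)=p(S),\ \widetilde x(Z)\ge p(Z)\ \forall Z\subset S\}$, $\widetilde x(Z)=\sum_{s\in Z}x(s)$, with $p$ a set-function with values in $\mathbb{Z}\cup\{ -\infty\}$, $p(\emptyset)=0$, $p(S)$ finite, supermodular ($p(X)+p(Y)\le p(X\cap Y)+p(X\cup Y)$ whenever finite). $\Phi$ is symmetric if $\Phi(z(1),\dots,z(n))=\Phi(z(\sigma(1)),\dots,z(\sigma(n)))$ for all permutations $\sigma$; convex if $\lambda\Phi(x)+(1-\lambda)\Phi(y)\ge\Phi(\lambda x+(1-\lambda)y)$ whenever $x,y\in\mathbb{Z}^S$, $0<\lambda<1$ and $\lambda x+(1-\lambda)y$ is integral. With $x{\downarrow}$ the decreasing rearrangement, $m$ is decreasingly minimal in $B\cap\mathbb{Z}^S$ if for every $y$ in it, $m{\downarrow}=y{\downarrow}$ or $m{\downarrow}(j)<y{\downarrow}(j)$ at the first differing index. -}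

module Defs where

open import Level using (Level; _⊔_) renaming (suc to lsuc)
open import Data.Nat using (ℕ; zero; suc; NonZero)
import Data.Nat as ℕ
open import Data.Integer as ℤ using (ℤ; +_; 0ℤ)
import Data.Integer.Properties as ℤP
open import Data.Bool using (Bool; true; false; if_then_else_)
open import Data.Fin using (Fin)
import Data.Fin as Fin
open import Data.Fin.Subset using (Subset; _∩_; _∪_; ⊥; ⊤)
open import Data.Fin.Permutation using (Permutation′; _⟨$⟩ʳ_)
open import Data.Vec using ([]; _∷_)
open import Data.List using (List; []; _∷_; reverse)
open import Data.List.Sort ℤP.≤-decTotalOrder using (sort)
open import Data.Vec.Functional using (toList)
open import Data.Product using (Σ; ∃; ∃₂; _×_; _,_)
open import Data.Sum using (_⊎_)
open import Function using (_∘_)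
open import Relation.Binary using (Rel; IsTotalOrder)
open import Relation.Binary.PropositionalEquality using (_≡_)
open import Algebra.Bundles using (AbelianGroup)

-- Ground set S = Fin n; vectors in ℤ^S are functions Fin n → ℤ;
-- subsets Z ⊆ S are Data.Fin.Subset (Vec Bool n).

data ℤ₋∞ : Set where
  -∞  : ℤ₋∞
  fin : ℤ → ℤ₋∞

x̃ : ∀ {n} → (Fin n → ℤ) → Subset n → ℤ
x̃ {zero}  x []      = 0ℤ
x̃ {suc n} x (b ∷ Z) = (if b then x Fin.zero else 0ℤ) ℤ.+ x̃ (x ∘ Fin.suc) Z

-- p is a supermodular set function with values in ℤ ∪ {-∞},
-- p(∅) = 0, p(S) finite; the supermodular inequality is required
-- whenever p(X) and p(Y) are finite (this forces p(X∩Y), p(X∪Y) finite).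
record Supermodular (n : ℕ) (p : Subset n → ℤ₋∞) : Set where
  field
    p-∅ : p ⊥ ≡ fin 0ℤ
    p-S : ∃ λ c → p ⊤ ≡ fin c
    supermod : ∀ X Y a b → p X ≡ fin a → p Y ≡ fin b →
      ∃₂ λ c d → p (X ∩ Y) ≡ fin c × p (X ∪ Y) ≡ fin d × (a ℤ.+ b) ℤ.≤ (c ℤ.+ d)

_≥∞_ : ℤ → ℤ₋∞ → Set
v ≥∞ -∞    = Data.Unit.⊤ where import Data.Unit
v ≥∞ fin a = a ℤ.≤ v

InB : ∀ {n} → (Subset n → ℤ₋∞) → (Fin n → ℤ) → Set
InB p x = (fin (x̃ x ⊤) ≡ p ⊤) × (∀ Z → x̃ x Z ≥∞ p Z)

_↓ : ∀ {n} → (Fin n → ℤ) → List ℤ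
x ↓ = reverse (sort (toList x))

data LexLess : List ℤ → List ℤ → Set where
  here : ∀ {a b xs ys} → a ℤ.< b → LexLess (a ∷ xs) (b ∷ ys)
  next : ∀ {a xs ys} → LexLess xs ys → LexLess (a ∷ xs) (a ∷ ys)

DecMin : ∀ {n} → (Subset n → ℤ₋∞) → (Fin n → ℤ) → Set
DecMin p m = InB p m × (∀ y → InB p y → (m ↓ ≡ y ↓) ⊎ LexLess (m ↓) (y ↓))

-- Codomain of Φ: a totally ordered abelian group (ℝ is one).

record OrderedAbelianGroup c ℓ₁ ℓ₂ : Set (lsuc (c ⊔ ℓ₁ ⊔ ℓ₂)) where
  field
    abelianGroup : AbelianGroup c ℓ₁
  open AbelianGroup abelianGroup public
  field
    _≤_          : Rel Carrier ℓ₂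
    isTotalOrder : IsTotalOrder _≈_ _≤_
    ∙-monoˡ-≤    : ∀ {x y} z → x ≤ y → (x ∙ z) ≤ (y ∙ z)

  _·_ : ℕ → Carrier → Carrier
  zero  · u = ε
  suc k · u = u ∙ (k · u)

module _ {c ℓ₁ ℓ₂} (R : OrderedAbelianGroup c ℓ₁ ℓ₂) where
  open OrderedAbelianGroup R

  Symmetric : ∀ {n} → ((Fin n → ℤ) → Carrier) → Set ℓ₁
  Symmetric {n} Φ = ∀ (σ : Permutation′ n) z → Φ z ≈ Φ (z ∘ (σ ⟨$⟩ʳ_))

  -- discrete convexity: λΦ(x) + (1-λ)Φ(y) ≥ Φ(λx + (1-λ)y) whenever
  -- 0 < λ < 1 and λx+(1-λ)y is integral.  Written with λ = a/(a+b),
  -- a, b ≥ 1, cleared of denominators.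
  Convex : ∀ {n} → ((Fin n → ℤ) → Carrier) → Set ℓ₂
  Convex {n} Φ = ∀ (x y z : Fin n → ℤ) (a b : ℕ) → .{{NonZero a}} → .{{NonZero b}} →
    (∀ s → (+ (a ℕ.+ b)) ℤ.* z s ≡ (+ a) ℤ.* x s ℤ.+ (+ b) ℤ.* y s) →
    ((a ℕ.+ b) · Φ z) ≤ ((a · Φ x) ∙ (b · Φ y))

  Minimizer : ∀ {n} → (Subset n → ℤ₋∞) → ((Fin n → ℤ) → Carrier) → (Fin n → ℤ) → Set ℓ₂
  Minimizer p Φ m = InB p m × (∀ y → InB p y → Φ m ≤ Φ y)

module Submission where

-- Let m be decreasingly minimal and y ∈ B with y ≠ m. Take s with m s < y s and y s maximal.
-- Tight sets of a base are closed under ∩, which yields the exchange property: some t has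
-- y t < m t and y − χ_s + χ_t ∈ B. Exchanging the other way gives s′ with m s′ < y s′ and
-- m − χ_t + χ_s′ ∈ B, and decreasing minimality forbids such a move unless m t ≤ m s′ + 1;
-- hence y t < m t ≤ y s′ ≤ y s. With y t < y s, the vector y − χ_s + χ_t is a convex
-- combination of y and y with coordinates s, t swapped, so symmetry and convexity give
-- Φ(y − χ_s + χ_t) ≤ Φ(y). The ℓ₁-distance to m drops, so induction reaches Φ(m) ≤ Φ(y).

open import Defs
open import Data.Nat using (ℕ)
open import Data.Integer using (ℤ)
open import Data.Fin using (Fin)
open import Data.Fin.Subset using (Subset)

open import Data.Nat as ℕ using (zero; suc; z≤n; s≤s; NonZero)
import Data.Nat.Properties as ℕₚ
open import Data.Nat.Induction using (<-wellFounded)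
open import Data.Nat.ListAction using (sum)
open import Data.Nat.ListAction.Properties using (sum-↭)
open import Data.Integer as ℤ
  using (+_; 0ℤ; 1ℤ; -1ℤ; _+_; _-_; -_; _*_; _≤_; _<_; _≤?_; _<?_; ∣_∣)
import Data.Integer.Properties as ℤₚ
open import Data.Integer.Tactic.RingSolver using (solve-∀)
open import Algebra.Properties.CommutativeSemigroup ℤₚ.+-commutativeSemigroup
  using (interchange)
open import Data.Bool using (Bool; true; false; if_then_else_; _∧_; _∨_)
open import Data.Fin using (zero; suc)
import Data.Fin.Properties as Finₚ
open import Data.Fin.Subset using (_∈_; _∉_; _∩_; _∪_; ⊤)
open import Data.Fin.Subset.Properties using (_∈?_; ∈⊤; x∈p∩q⁺; x∈p∩q⁻; anySubset?)
open import Data.Fin.Permutation using (transpose; _⟨$⟩ʳ_)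
import Data.Fin.Permutation.Components as PC
open import Data.Vec using ([]; _∷_; here; there)
open import Data.List using (List; []; _∷_; map; tabulate; reverse; filter; allFin)
open import Data.List.Properties using (map-tabulate; unfold-reverse)
open import Data.List.Membership.Propositional using () renaming (_∈_ to _∈ₗ_)
open import Data.List.Membership.Propositional.Properties using (∈-filter⁺; ∈-filter⁻; ∈-allFin)
open import Data.List.Relation.Unary.All as All using (All; []; _∷_)
import Data.List.Relation.Unary.All.Properties as Allₚ
open import Data.List.Relation.Unary.AllPairs using (AllPairs; []; _∷_)
import Data.List.Relation.Unary.AllPairs.Properties as AllPairsₚ
open import Data.List.Relation.Unary.Linked.Properties using (Linked⇒AllPairs)
open import Data.List.Relation.Binary.Permutation.Propositional using (↭-sym; ↭-trans)
open import Data.List.Relation.Binary.Permutation.Propositional.Properties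
  using (↭-reverse; All-resp-↭; map⁺)
open import Data.List.Sort ℤₚ.≤-decTotalOrder using (sort-↭; sort-↗)
import Data.List.Extrema ℤₚ.≤-totalOrder as Extrema
open import Data.Vec.Functional using (toList)
open import Data.Product using (∃; _×_; _,_; proj₁; proj₂)
open import Data.Sum using (_⊎_; inj₁; inj₂)
open import Data.Unit using (tt)
open import Function using (_∘_; flip)
open import Induction.WellFounded using (Acc; acc)
open import Relation.Nullary using (Dec; yes; no; ¬_; does; contradiction)
open import Relation.Nullary.Decidable
  using (_×-dec_; ¬?; map′; dec-true; dec-false; decidable-stable)
open import Relation.Unary using (Pred; Decidable)
open import Relation.Binary using (Rel; IsTotalOrder)
open import Relation.Binary.PropositionalEquality
  using (_≡_; _≢_; refl; sym; trans; cong; cong₂; subst; subst₂; module ≡-Reasoning)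

private variable
  n : ℕ

<⇒gap : ∀ {i j} → i < j → ∃ λ a → j ≡ i + + suc a
<⇒gap {i} {j} i<j = ∣ j - ℤ.suc i ∣ , (begin
  j                             ≡⟨ decompose i j ⟩
  i + (1ℤ + (j - ℤ.suc i))      ≡⟨ cong (λ d → i + (1ℤ + d)) (sym (ℤₚ.0≤i⇒+∣i∣≡i 0≤d)) ⟩
  i + (1ℤ + + ∣ j - ℤ.suc i ∣)  ∎)
  where
  open ≡-Reasoning
  0≤d : 0ℤ ≤ j - ℤ.suc i
  0≤d = ℤₚ.i≤j⇒0≤j-i (ℤₚ.i<j⇒suc[i]≤j i<j)
  decompose : ∀ i j → j ≡ i + (1ℤ + (j - (1ℤ + i)))
  decompose = solve-∀

≤-+-squeezeˡ : ∀ {c d α β} → c ≤ α → d ≤ β → α + β ≤ c + d → α ≡ c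
≤-+-squeezeˡ c≤α d≤β α+β≤c+d =
  ℤₚ.≤-antisym (ℤₚ.≮⇒≥ λ c<α → ℤₚ.<⇒≱ (ℤₚ.+-mono-<-≤ c<α d≤β) α+β≤c+d) c≤α

∣-1∣<∣∣ : ∀ {p q} → q < p → ∣ (p - 1ℤ) - q ∣ ℕ.< ∣ p - q ∣
∣-1∣<∣∣ {q = q} q<p with <⇒gap q<p
... | a , refl = subst₂ (λ u v → ∣ u ∣ ℕ.< ∣ v ∣)
  (sym (lower q (+ a))) (sym (whole q (+ a))) (ℕₚ.n<1+n a)
  where
  lower : ∀ q a → (q + (1ℤ + a) - 1ℤ) - q ≡ a
  lower = solve-∀
  whole : ∀ q a → (q + (1ℤ + a)) - q ≡ 1ℤ + a
  whole = solve-∀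

∣+1∣≤∣∣ : ∀ {p q} → p < q → ∣ (p + 1ℤ) - q ∣ ℕ.≤ ∣ p - q ∣
∣+1∣≤∣∣ {p} p<q with <⇒gap p<q
... | a , refl = subst₂ (λ u v → ∣ u ∣ ℕ.≤ ∣ v ∣)
  (sym (raised p (+ a))) (sym (whole p (+ a)))
  (subst (ℕ._≤ suc a) (sym (ℤₚ.∣-i∣≡∣i∣ (+ a))) (ℕₚ.n≤1+n a))
  where
  raised : ∀ p a → (p + 1ℤ) - (p + (1ℤ + a)) ≡ - a
  raised = solve-∀
  whole : ∀ p a → p - (p + (1ℤ + a)) ≡ - (1ℤ + a)
  whole = solve-∀

sum-tabulate-mono-≤ : {f g : Fin n → ℕ} → (∀ i → f i ℕ.≤ g i) →
  sum (tabulate f) ℕ.≤ sum (tabulate g)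
sum-tabulate-mono-≤ {zero}  f≤g = z≤n
sum-tabulate-mono-≤ {suc n} f≤g = ℕₚ.+-mono-≤ (f≤g zero) (sum-tabulate-mono-≤ (f≤g ∘ suc))

sum-tabulate-mono-< : {f g : Fin n → ℕ} → (∀ i → f i ℕ.≤ g i) → ∀ j → f j ℕ.< g j →
  sum (tabulate f) ℕ.< sum (tabulate g)
sum-tabulate-mono-< f≤g zero    fj<gj = ℕₚ.+-mono-<-≤ fj<gj (sum-tabulate-mono-≤ (f≤g ∘ suc))
sum-tabulate-mono-< f≤g (suc j) fj<gj =
  ℕₚ.+-mono-≤-< (f≤g zero) (sum-tabulate-mono-< (f≤g ∘ suc) j fj<gj)

-- Unit vectors and the modular function x̃

χ : Fin n → Fin n → ℤ
χ zero    zero    = 1ℤ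
χ zero    (suc _) = 0ℤ
χ (suc _) zero    = 0ℤ
χ (suc u) (suc i) = χ u i

move : (Fin n → ℤ) → Fin n → Fin n → Fin n → ℤ
move x u v i = x i + (χ v i - χ u i)

χ-same : (u : Fin n) → χ u u ≡ 1ℤ
χ-same zero    = refl
χ-same (suc u) = χ-same u

χ-other : {u i : Fin n} → u ≢ i → χ u i ≡ 0ℤ
χ-other {u = zero}  {zero}  u≢i = contradiction refl u≢i
χ-other {u = zero}  {suc i} u≢i = refl
χ-other {u = suc u} {zero}  u≢i = refl
χ-other {u = suc u} {suc i} u≢i = χ-other (u≢i ∘ cong suc)

module _ (x : Fin n → ℤ) {u v : Fin n} where

  move-source : u ≢ v → move x u v u ≡ x u - 1ℤ
  move-source u≢v rewrite χ-same u | χ-other (u≢v ∘ sym) = refl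

  move-target : u ≢ v → move x u v v ≡ x v + 1ℤ
  move-target u≢v rewrite χ-same v | χ-other u≢v = refl

  move-other : ∀ {i} → u ≢ i → v ≢ i → move x u v i ≡ x i
  move-other {i} u≢i v≢i rewrite χ-other u≢i | χ-other v≢i = ℤₚ.+-identityʳ (x i)

x̃-zero : (Z : Subset n) → x̃ (λ _ → 0ℤ) Z ≡ 0ℤ
x̃-zero []          = refl
x̃-zero (true ∷ Z)  = cong (_+_ 0ℤ) (x̃-zero Z)
x̃-zero (false ∷ Z) = cong (_+_ 0ℤ) (x̃-zero Z)

x̃-+ : (f g : Fin n → ℤ) (Z : Subset n) → x̃ (λ i → f i + g i) Z ≡ x̃ f Z + x̃ g Z
x̃-+ f g []          = refl
x̃-+ f g (true ∷ Z)  =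
  trans (cong (_+_ (f zero + g zero)) (x̃-+ (f ∘ suc) (g ∘ suc) Z))
    (interchange (f zero) (g zero) (x̃ (f ∘ suc) Z) (x̃ (g ∘ suc) Z))
x̃-+ f g (false ∷ Z) = trans (ℤₚ.+-identityˡ _) (trans (x̃-+ (f ∘ suc) (g ∘ suc) Z)
  (sym (cong₂ _+_ (ℤₚ.+-identityˡ (x̃ (f ∘ suc) Z)) (ℤₚ.+-identityˡ (x̃ (g ∘ suc) Z)))))

x̃-neg : (f : Fin n → ℤ) (Z : Subset n) → x̃ (λ i → - f i) Z ≡ - x̃ f Z
x̃-neg f []          = refl
x̃-neg f (true ∷ Z)  =
  trans (cong (_+_ (- f zero)) (x̃-neg (f ∘ suc) Z)) (sym (ℤₚ.neg-distrib-+ (f zero) _))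
x̃-neg f (false ∷ Z) = trans (ℤₚ.+-identityˡ _)
  (trans (x̃-neg (f ∘ suc) Z) (cong -_ (sym (ℤₚ.+-identityˡ _))))

x̃-move : (x : Fin n → ℤ) (u v : Fin n) (Z : Subset n) →
  x̃ (move x u v) Z ≡ x̃ x Z + (x̃ (χ v) Z - x̃ (χ u) Z)
x̃-move x u v Z = trans (x̃-+ x _ Z)
  (cong (_+_ (x̃ x Z)) (trans (x̃-+ (χ v) _ Z) (cong (_+_ (x̃ (χ v) Z)) (x̃-neg (χ u) Z))))

x̃-χ-suc : ∀ {u : Fin n} b Z → x̃ (χ (suc u)) (b ∷ Z) ≡ x̃ (χ u) Z
x̃-χ-suc true  Z = ℤₚ.+-identityˡ _
x̃-χ-suc false Z = ℤₚ.+-identityˡ _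

x̃-χ-∈ : ∀ {u : Fin n} {Z} → u ∈ Z → x̃ (χ u) Z ≡ 1ℤ
x̃-χ-∈ {Z = true ∷ Z}   here        = cong (_+_ 1ℤ) (x̃-zero Z)
x̃-χ-∈ {u = suc u} {b ∷ Z} (there u∈Z) = trans (x̃-χ-suc {u = u} b Z) (x̃-χ-∈ u∈Z)

x̃-χ-∉ : ∀ {u : Fin n} {Z} → u ∉ Z → x̃ (χ u) Z ≡ 0ℤ
x̃-χ-∉ {u = zero}  {true ∷ Z}  u∉Z = contradiction here u∉Z
x̃-χ-∉ {u = zero}  {false ∷ Z} u∉Z = trans (ℤₚ.+-identityˡ _) (x̃-zero Z)
x̃-χ-∉ {u = suc u} {b ∷ Z}     u∉Z = trans (x̃-χ-suc {u = u} b Z) (x̃-χ-∉ (u∉Z ∘ there))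

x̃-mono-≤ : {y x : Fin n → ℤ} (Z : Subset n) → (∀ {i} → i ∈ Z → y i ≤ x i) → x̃ y Z ≤ x̃ x Z
x̃-mono-≤ []          y≤x = ℤₚ.≤-refl
x̃-mono-≤ (true ∷ Z)  y≤x = ℤₚ.+-mono-≤ (y≤x here) (x̃-mono-≤ Z (y≤x ∘ there))
x̃-mono-≤ (false ∷ Z) y≤x = ℤₚ.+-monoʳ-≤ 0ℤ (x̃-mono-≤ Z (y≤x ∘ there))

x̃-mono-< : {y x : Fin n → ℤ} (Z : Subset n) → (∀ {i} → i ∈ Z → y i ≤ x i) →
  ∀ {u} → u ∈ Z → y u < x u → x̃ y Z < x̃ x Z
x̃-mono-< (true ∷ Z)  y≤x here        yu<xu = ℤₚ.+-mono-<-≤ yu<xu (x̃-mono-≤ Z (y≤x ∘ there))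
x̃-mono-< (true ∷ Z)  y≤x (there u∈Z) yu<xu =
  ℤₚ.+-mono-≤-< (y≤x here) (x̃-mono-< Z (y≤x ∘ there) u∈Z yu<xu)
x̃-mono-< (false ∷ Z) y≤x (there u∈Z) yu<xu = ℤₚ.+-monoʳ-< 0ℤ (x̃-mono-< Z (y≤x ∘ there) u∈Z yu<xu)

x̃-modular : (x : Fin n → ℤ) (X Y : Subset n) → x̃ x (X ∩ Y) + x̃ x (X ∪ Y) ≡ x̃ x X + x̃ x Y
x̃-modular x []      []      = refl
x̃-modular x (b ∷ X) (c ∷ Y) =
  trans (interchange (at (b ∧ c)) (x̃ x′ (X ∩ Y)) (at (b ∨ c)) (x̃ x′ (X ∪ Y)))
  (trans (cong₂ _+_ (head b c) (x̃-modular x′ X Y)) (interchange (at b) (at c) (x̃ x′ X) (x̃ x′ Y)))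
  where
  x′ = x ∘ suc
  at : Bool → ℤ
  at b = if b then x zero else 0ℤ
  head : ∀ b c → at (b ∧ c) + at (b ∨ c) ≡ at b + at c
  head true  true  = refl
  head true  false = ℤₚ.+-comm 0ℤ (x zero)
  head false true  = refl
  head false false = refl

-- Tight sets and the exchange property

fin-injective : ∀ {a b} → fin a ≡ fin b → a ≡ b
fin-injective refl = refl

_≟∞_ : (a b : ℤ₋∞) → Dec (a ≡ b)
-∞    ≟∞ -∞    = yes refl
-∞    ≟∞ fin _ = no λ ()
fin _ ≟∞ -∞    = no λ ()
fin a ≟∞ fin b = map′ (cong fin) fin-injective (a ℤ.≟ b)

≥∞-fin : ∀ {A a q} → q ≡ fin a → A ≥∞ q → a ≤ A
≥∞-fin refl a≤A = a≤A

≥∞-mono : ∀ {A B} q → A ≤ B → A ≥∞ q → B ≥∞ q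
≥∞-mono -∞      _   _   = tt
≥∞-mono (fin a) A≤B a≤A = ℤₚ.≤-trans a≤A A≤B

≥∞-pred : ∀ {A} q → A ≥∞ q → fin A ≢ q → (A - 1ℤ) ≥∞ q
≥∞-pred -∞      _   _   = tt
≥∞-pred {A} (fin a) a≤A A≢a = subst (a ≤_) (ℤₚ.+-comm -1ℤ A)
  (ℤₚ.i<j⇒i≤pred[j] (ℤₚ.≤∧≢⇒< a≤A (A≢a ∘ cong fin ∘ sym)))

InB-≤⇒≗ : ∀ {p : Subset n → ℤ₋∞} {x y} → InB p x → InB p y → (∀ i → y i ≤ x i) → ∀ i → x i ≡ y i
InB-≤⇒≗ {x = x} {y} x∈B y∈B y≤x i = ℤₚ.≤-antisym (ℤₚ.≮⇒≥ yi≮xi) (y≤x i)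
  where
  yi≮xi : ¬ y i < x i
  yi≮xi yi<xi = ℤₚ.<-irrefl (fin-injective (trans (proj₁ y∈B) (sym (proj₁ x∈B))))
    (x̃-mono-< ⊤ (λ {j} _ → y≤x j) ∈⊤ yi<xi)

Tight : (Subset n → ℤ₋∞) → (Fin n → ℤ) → Subset n → Set
Tight p x Z = fin (x̃ x Z) ≡ p Z

tight-bound : ∀ {p : Subset n → ℤ₋∞} {x z Z} → InB p z → Tight p x Z → x̃ x Z ≤ x̃ z Z
tight-bound z∈B Z-tight = ≥∞-fin (sym Z-tight) (proj₂ z∈B _)

tight-∩ : ∀ {p : Subset n → ℤ₋∞} {x X Y} → Supermodular n p → InB p x →
  Tight p x X → Tight p x Y → Tight p x (X ∩ Y)
tight-∩ {x = x} {X} {Y} supermodular x∈B X-tight Y-tight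
  with Supermodular.supermod supermodular X Y _ _ (sym X-tight) (sym Y-tight)
... | c , d , p∩≡c , p∪≡d , sum≤ = trans (cong fin ∩≡c) (sym p∩≡c)
  where
  ∩≡c : x̃ x (X ∩ Y) ≡ c
  ∩≡c = ≤-+-squeezeˡ (≥∞-fin p∩≡c (proj₂ x∈B (X ∩ Y))) (≥∞-fin p∪≡d (proj₂ x∈B (X ∪ Y)))
    (subst (_≤ c + d) (sym (x̃-modular x X Y)) sum≤)

TightSeparated : (Subset n → ℤ₋∞) → (Fin n → ℤ) → Fin n → Fin n → Set
TightSeparated p x u v = ∃ λ Z → Tight p x Z × u ∈ Z × v ∉ Z

move-∈B : ∀ {p : Subset n → ℤ₋∞} {x u v} → InB p x → ¬ TightSeparated p x u v → InB p (move x u v)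
move-∈B {p = p} {x} {u} {v} x∈B ¬separated = total , bounded
  where
  total : fin (x̃ (move x u v) ⊤) ≡ p ⊤
  total = trans (cong fin (trans (x̃-move x u v ⊤) (trans
    (cong₂ (λ a b → x̃ x ⊤ + (a - b)) (x̃-χ-∈ {u = v} ∈⊤) (x̃-χ-∈ {u = u} ∈⊤))
    (ℤₚ.+-identityʳ _))))
    (proj₁ x∈B)
  bounded : ∀ Z → x̃ (move x u v) Z ≥∞ p Z
  bounded Z = subst (_≥∞ p Z) (sym (x̃-move x u v Z)) (shifted (u ∈? Z) (v ∈? Z))
    where
    A = x̃ x Z
    shifted : Dec (u ∈ Z) → Dec (v ∈ Z) → (A + (x̃ (χ v) Z - x̃ (χ u) Z)) ≥∞ p Z
    shifted (yes u∈Z) (yes v∈Z) rewrite x̃-χ-∈ u∈Z | x̃-χ-∈ v∈Z =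
      ≥∞-mono (p Z) (ℤₚ.i≤i+j A 0ℤ) (proj₂ x∈B Z)
    shifted (no u∉Z)  (yes v∈Z) rewrite x̃-χ-∉ u∉Z | x̃-χ-∈ v∈Z =
      ≥∞-mono (p Z) (ℤₚ.i≤i+j A 1ℤ) (proj₂ x∈B Z)
    shifted (no u∉Z)  (no v∉Z)  rewrite x̃-χ-∉ u∉Z | x̃-χ-∉ v∉Z =
      ≥∞-mono (p Z) (ℤₚ.i≤i+j A 0ℤ) (proj₂ x∈B Z)
    shifted (yes u∈Z) (no v∉Z)  rewrite x̃-χ-∈ u∈Z | x̃-χ-∉ v∉Z =
      ≥∞-pred (p Z) (proj₂ x∈B Z) (λ Z-tight → ¬separated (Z , Z-tight , u∈Z , v∉Z))

module _ {p : Subset n → ℤ₋∞} (supermodular : Supermodular n p)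
  {x : Fin n → ℤ} (x∈B : InB p x) where

  exceeds? : (z : Fin n → ℤ) → Decidable (λ v → x v < z v)
  exceeds? z v = x v <? z v

  tightSeparated? : ∀ u v → Dec (TightSeparated p x u v)
  tightSeparated? u v = anySubset? λ Z → (fin (x̃ x Z) ≟∞ p Z) ×-dec ((u ∈? Z) ×-dec ¬? (v ∈? Z))

  tight-set-avoiding : ∀ {u vs} → All (TightSeparated p x u) vs →
    ∃ λ Z → Tight p x Z × u ∈ Z × All (_∉ Z) vs
  tight-set-avoiding [] = ⊤ , proj₁ x∈B , ∈⊤ , []
  tight-set-avoiding ((W , W-tight , u∈W , v∉W) ∷ separations)
    with tight-set-avoiding separations
  ... | Z , Z-tight , u∈Z , avoids = W ∩ Z , tight-∩ supermodular x∈B W-tight Z-tight ,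
    x∈p∩q⁺ (u∈W , u∈Z) ,
    (v∉W ∘ proj₁ ∘ x∈p∩q⁻ W Z) ∷ All.map (λ v∉Z → v∉Z ∘ proj₂ ∘ x∈p∩q⁻ W Z) avoids

  separated⇒≤ : ∀ {z u} → InB p z →
    All (TightSeparated p x u) (filter (exceeds? z) (allFin n)) → x u ≤ z u
  separated⇒≤ {z} {u} z∈B separations with tight-set-avoiding separations
  ... | Z , Z-tight , u∈Z , avoids =
    ℤₚ.≮⇒≥ λ zu<xu → ℤₚ.<⇒≱ (x̃-mono-< Z z≤x u∈Z zu<xu) (tight-bound z∈B Z-tight)
    where
    z≤x : ∀ {i} → i ∈ Z → z i ≤ x i
    z≤x {i} i∈Z =
      ℤₚ.≮⇒≥ λ xi<zi → All.lookup avoids (∈-filter⁺ (exceeds? z) (∈-allFin i) xi<zi) i∈Z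

  exchange : ∀ {z u} → InB p z → z u < x u → ∃ λ v → x v < z v × InB p (move x u v)
  exchange {z} {u} z∈B zu<xu with Finₚ.any? (λ v → exceeds? z v ×-dec ¬? (tightSeparated? u v))
  ... | yes (v , xv<zv , ¬separated) = v , xv<zv , move-∈B x∈B ¬separated
  ... | no ∄ = contradiction (separated⇒≤ z∈B (All.tabulate separated)) (ℤₚ.<⇒≱ zu<xu)
    where
    separated : ∀ {v} → v ∈ₗ filter (exceeds? z) (allFin n) → TightSeparated p x u v
    separated {v} v∈ = decidable-stable (tightSeparated? u v)
      λ ¬separated → ∄ (v , proj₂ (∈-filter⁻ (exceeds? z) {xs = allFin n} v∈) , ¬separated)

-- Decreasing rearrangements via threshold counts

[_≤_] : ℤ → ℤ → ℕ
[ k ≤ v ] = if does (k ≤? v) then 1 else 0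

[≤]-one : ∀ {k v} → k ≤ v → [ k ≤ v ] ≡ 1
[≤]-one {k} {v} k≤v rewrite dec-true (k ≤? v) k≤v = refl

[≤]-zero : ∀ {k v} → v < k → [ k ≤ v ] ≡ 0
[≤]-zero {k} {v} v<k rewrite dec-false (k ≤? v) (ℤₚ.<⇒≱ v<k) = refl

[≤]-mono : ∀ k {v w} → v ≤ w → [ k ≤ v ] ℕ.≤ [ k ≤ w ]
[≤]-mono k {v} v≤w with k ≤? v
... | no _    = z≤n
... | yes k≤v rewrite [≤]-one (ℤₚ.≤-trans k≤v v≤w) = ℕₚ.≤-refl

count≥ : ℤ → List ℤ → ℕ
count≥ k vs = sum (map (λ v → [ k ≤ v ]) vs)

count≥-↓ : ∀ k (x : Fin n → ℤ) → count≥ k (x ↓) ≡ sum (tabulate (λ i → [ k ≤ x i ]))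
count≥-↓ k x = trans (sum-↭ (map⁺ _ (↭-trans (↭-reverse _) (sort-↭ (toList x)))))
  (cong sum (map-tabulate x _))

count≥-none : ∀ {k vs} → All (_< k) vs → count≥ k vs ≡ 0
count≥-none []            = refl
count≥-none (v<k ∷ vs<k) rewrite [≤]-zero v<k = count≥-none vs<k

AllPairs-reverse⁺ : ∀ {a ℓ} {A : Set a} {R : Rel A ℓ} {xs} →
  AllPairs R xs → AllPairs (flip R) (reverse xs)
AllPairs-reverse⁺ []                          = []
AllPairs-reverse⁺ {R = R} {x ∷ xs} (Rx ∷ Rxs) rewrite unfold-reverse x xs =
  AllPairsₚ.++⁺ (AllPairs-reverse⁺ Rxs) ([] ∷ [])
    (All.map (_∷ []) (All-resp-↭ (↭-sym (↭-reverse xs)) Rx))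

Descending : List ℤ → Set
Descending = AllPairs ℤ._≥_

↓-descending : (x : Fin n → ℤ) → Descending (x ↓)
↓-descending x = AllPairs-reverse⁺ (Linked⇒AllPairs ℤₚ.≤-trans (sort-↗ (toList x)))

infix 4 _≤lex_

_≤lex_ : List ℤ → List ℤ → Set
E ≤lex D = (E ≡ D) ⊎ LexLess E D

lexLess⇒count≥ : ∀ {E D} → Descending E → LexLess E D →
  ∃ λ k → count≥ k E ℕ.< count≥ k D × (∀ {k′} → k < k′ → count≥ k′ E ℕ.≤ count≥ k′ D)
lexLess⇒count≥ {e ∷ E} {d ∷ D} (e≥E ∷ _) (here e<d) =
  d , fewer , λ {k} d<k → subst (ℕ._≤ count≥ k (d ∷ D)) (sym (none-from (ℤₚ.<-trans e<d d<k))) z≤n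
  where
  none-from : ∀ {k} → e < k → count≥ k (e ∷ E) ≡ 0
  none-from e<k rewrite [≤]-zero e<k = count≥-none (All.map (λ a≤e → ℤₚ.≤-<-trans a≤e e<k) e≥E)
  fewer : count≥ d (e ∷ E) ℕ.< count≥ d (d ∷ D)
  fewer rewrite none-from e<d | [≤]-one (ℤₚ.≤-refl {d}) = s≤s z≤n
lexLess⇒count≥ {a ∷ E} (_ ∷ E↓) (next lex) with lexLess⇒count≥ E↓ lex
... | k , fewer , dominated =
  k , ℕₚ.+-monoʳ-< [ k ≤ a ] fewer , λ {k′} k<k′ → ℕₚ.+-monoʳ-≤ [ k′ ≤ a ] (dominated k<k′)

counts⇒¬≤lex : ∀ {b a} {x y : Fin n → ℤ} → b < a →
  (∀ {k} → b < k → count≥ k (y ↓) ℕ.≤ count≥ k (x ↓)) → count≥ a (y ↓) ℕ.< count≥ a (x ↓) →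
  ¬ (x ↓ ≤lex y ↓)
counts⇒¬≤lex {b = b} {a} {x} b<a dominated fewer (inj₁ x↓≡y↓) =
  ℕₚ.<-irrefl (cong (count≥ a) (sym x↓≡y↓)) fewer
counts⇒¬≤lex {b = b} {a} {x} b<a dominated fewer (inj₂ lex) with lexLess⇒count≥ (↓-descending x) lex
... | k , more , below with b <? k
...   | yes b<k = ℕₚ.<⇒≱ more (dominated b<k)
...   | no  b≮k = ℕₚ.<⇒≱ fewer (below (ℤₚ.≤-<-trans (ℤₚ.≮⇒≥ b≮k) b<a))

i-1<i : ∀ i → i - 1ℤ < i
i-1<i i = subst (i - 1ℤ <_) (ℤₚ.+-identityʳ i) (ℤₚ.+-monoʳ-< i (ℤ.-<+ {0} {0}))

-- For k > m s + 1 the move can only lower the number of entries ≥ k, and at k = m t it does.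
decMin-move-≤ : ∀ {p : Subset n → ℤ₋∞} {m} → DecMin p m →
  ∀ {t s} → InB p (move m t s) → m t ≤ m s + 1ℤ
decMin-move-≤ {m = m} (_ , minimal) {t} {s} moved∈B =
  ℤₚ.≮⇒≥ λ steep → counts⇒¬≤lex steep (dominated steep) (fewer steep) (minimal _ moved∈B)
  where
  m′ = move m t s
  t≢s : m s + 1ℤ < m t → t ≢ s
  t≢s steep refl = ℤₚ.<⇒≱ steep (ℤₚ.i≤i+j (m t) 1ℤ)
  pointwise : ∀ {k} → m s + 1ℤ < m t → m s + 1ℤ < k → ∀ i → [ k ≤ m′ i ] ℕ.≤ [ k ≤ m i ]
  pointwise {k} steep s+1<k i with i Finₚ.≟ t | i Finₚ.≟ s
  ... | yes refl | _        rewrite move-source m (t≢s steep) =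
    [≤]-mono k (ℤₚ.<⇒≤ (i-1<i (m t)))
  ... | no _     | yes refl rewrite move-target m (t≢s steep) | [≤]-zero s+1<k = z≤n
  ... | no i≢t   | no i≢s   rewrite move-other m (i≢t ∘ sym) (i≢s ∘ sym) = ℕₚ.≤-refl
  dominated : m s + 1ℤ < m t → ∀ {k} → m s + 1ℤ < k → count≥ k (m′ ↓) ℕ.≤ count≥ k (m ↓)
  dominated steep {k} s+1<k = subst₂ ℕ._≤_ (sym (count≥-↓ k m′)) (sym (count≥-↓ k m))
    (sum-tabulate-mono-≤ (pointwise steep s+1<k))
  fewer : m s + 1ℤ < m t → count≥ (m t) (m′ ↓) ℕ.< count≥ (m t) (m ↓)
  fewer steep = subst₂ ℕ._<_ (sym (count≥-↓ (m t) m′)) (sym (count≥-↓ (m t) m))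
    (sum-tabulate-mono-< (pointwise steep steep) t drop-at-t)
    where
    drop-at-t : [ m t ≤ m′ t ] ℕ.< [ m t ≤ m t ]
    drop-at-t rewrite move-source m (t≢s steep) | [≤]-zero (i-1<i (m t))
                    | [≤]-one (ℤₚ.≤-refl {m t}) = s≤s z≤n

ℓ₁ : (Fin n → ℤ) → (Fin n → ℤ) → ℕ
ℓ₁ x y = sum (tabulate λ i → ∣ x i - y i ∣)

ℓ₁-move-< : ∀ {y m : Fin n → ℤ} {s t} → m s < y s → y t < m t → ℓ₁ (move y s t) m ℕ.< ℓ₁ y m
ℓ₁-move-< {y = y} {m} {s} {t} ms<ys yt<mt =
  sum-tabulate-mono-< closer s (subst (λ v → ∣ v - m s ∣ ℕ.< ∣ y s - m s ∣)
    (sym (move-source y s≢t)) (∣-1∣<∣∣ ms<ys))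
  where
  s≢t : s ≢ t
  s≢t refl = ℤₚ.<-asym ms<ys yt<mt
  closer : ∀ i → ∣ move y s t i - m i ∣ ℕ.≤ ∣ y i - m i ∣
  closer i with i Finₚ.≟ s | i Finₚ.≟ t
  ... | yes refl | _        rewrite move-source y s≢t = ℕₚ.<⇒≤ (∣-1∣<∣∣ ms<ys)
  ... | no _     | yes refl rewrite move-target y s≢t = ∣+1∣≤∣∣ yt<mt
  ... | no i≢s   | no i≢t   rewrite move-other y (i≢s ∘ sym) (i≢t ∘ sym) = ℕₚ.≤-refl

∃-argmax : ∀ {ℓ} {P : Pred (Fin n) ℓ} → Decidable P → (f : Fin n → ℤ) → ∃ P →
  ∃ λ s → P s × (∀ v → P v → f v ≤ f s)
∃-argmax {n} P? f (u , Pu) =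
  s , Extrema.argmax-all f Pu (Allₚ.all-filter P? (allFin n)) ,
  λ v Pv → All.lookup (Extrema.f[xs]≤f[argmax] {f = f} u candidates) (∈-filter⁺ P? (∈-allFin v) Pv)
  where
  candidates = filter P? (allFin n)
  s = Extrema.argmax f u candidates

decMin-exchange-gap : ∀ {p : Subset n → ℤ₋∞} {m y} → Supermodular n p → DecMin p m → InB p y →
  ∀ {s t} → y t < m t → (∀ v → m v < y v → y v ≤ y s) → y t < y s
decMin-exchange-gap {m = m} {y} supermodular m-decMin y∈B {s} {t} yt<mt maximal
  with exchange supermodular (proj₁ m-decMin) y∈B yt<mt
... | v , mv<yv , moved∈B = ℤₚ.<-≤-trans yt<mt (begin
  m t        ≤⟨ decMin-move-≤ m-decMin moved∈B ⟩
  m v + 1ℤ   ≡⟨ ℤₚ.+-comm (m v) 1ℤ ⟩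
  1ℤ + m v   ≤⟨ ℤₚ.i<j⇒suc[i]≤j mv<yv ⟩
  y v        ≤⟨ maximal v mv<yv ⟩
  y s        ∎)
  where open ℤₚ.≤-Reasoning

-- Symmetric convex functions

module OrderedAbelianGroupProperties {c ℓ ℓ′} (R : OrderedAbelianGroup c ℓ ℓ′) where

  open OrderedAbelianGroup R
    using (_≈_; _∙_; _⁻¹; _·_; ∙-cong; assoc; comm; identityˡ; identityʳ; inverseʳ;
           ∙-monoˡ-≤; isTotalOrder)
    renaming (_≤_ to _≼_; refl to ≈-refl; trans to ≈-trans)
  open IsTotalOrder isTotalOrder using (total; ≤-respˡ-≈; ≤-respʳ-≈)
    renaming (reflexive to ≼-reflexive; trans to ≼-trans)

  ∙-monoʳ-≤ : ∀ z {x y} → x ≼ y → (z ∙ x) ≼ (z ∙ y)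
  ∙-monoʳ-≤ z {x} {y} x≤y = ≤-respʳ-≈ (comm y z) (≤-respˡ-≈ (comm x z) (∙-monoˡ-≤ z x≤y))

  ·-congʳ : ∀ k {u v} → u ≈ v → (k · u) ≈ (k · v)
  ·-congʳ zero    u≈v = ≈-refl
  ·-congʳ (suc k) u≈v = ∙-cong u≈v (·-congʳ k u≈v)

  ·-monoʳ-≤ : ∀ k {u v} → u ≼ v → (k · u) ≼ (k · v)
  ·-monoʳ-≤ zero          u≤v = ≼-reflexive ≈-refl
  ·-monoʳ-≤ (suc k) {u} {v} u≤v = ≼-trans (∙-monoˡ-≤ (k · u) u≤v) (∙-monoʳ-≤ v (·-monoʳ-≤ k u≤v))

  ·-distribʳ-+ : ∀ a b u → ((a · u) ∙ (b · u)) ≈ ((a ℕ.+ b) · u)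
  ·-distribʳ-+ zero    b u = identityˡ (b · u)
  ·-distribʳ-+ (suc a) b u = ≈-trans (assoc u (a · u) (b · u)) (∙-cong ≈-refl (·-distribʳ-+ a b u))

  ∙-cancelʳ-≤ : ∀ w {u v} → (u ∙ w) ≼ (v ∙ w) → u ≼ v
  ∙-cancelʳ-≤ w {u} {v} uw≤vw =
    ≤-respʳ-≈ (cancel v) (≤-respˡ-≈ (cancel u) (∙-monoˡ-≤ (w ⁻¹) uw≤vw))
    where
    cancel : ∀ x → ((x ∙ w) ∙ (w ⁻¹)) ≈ x
    cancel x = ≈-trans (assoc x w (w ⁻¹)) (≈-trans (∙-cong ≈-refl (inverseʳ w)) (identityʳ x))

  ·-cancel-≤ : ∀ k {u v} → (suc k · u) ≼ (suc k · v) → u ≼ v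
  ·-cancel-≤ k {u} {v} ku≤kv with total u v
  ... | inj₁ u≤v = u≤v
  ... | inj₂ v≤u = ∙-cancelʳ-≤ (k · v) (≼-trans (∙-monoʳ-≤ u (·-monoʳ-≤ k v≤u)) ku≤kv)

module Convexity {c ℓ ℓ′} (R : OrderedAbelianGroup c ℓ ℓ′) {n}
  {Φ : (Fin n → ℤ) → OrderedAbelianGroup.Carrier R} (convex : Convex R Φ) where

  open OrderedAbelianGroup R using (_≈_; _∙_; _·_; ∙-cong; isTotalOrder)
    renaming (_≤_ to _≼_; refl to ≈-refl; trans to ≈-trans)
  open IsTotalOrder isTotalOrder using (≤-respʳ-≈)
  open OrderedAbelianGroupProperties R

  convex-≤-equal-ends : ∀ {x w z : Fin n → ℤ} a b .{{_ : NonZero b}} → Φ w ≈ Φ x →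
    (∀ i → + (suc a ℕ.+ b) * z i ≡ + suc a * x i + + b * w i) → Φ z ≼ Φ x
  convex-≤-equal-ends {x} {w} {z} a b Φw≈Φx combination =
    ·-cancel-≤ (a ℕ.+ b) (≤-respʳ-≈ equal-ends (convex x w z (suc a) b combination))
    where
    equal-ends : ((suc a · Φ x) ∙ (b · Φ w)) ≈ ((suc a ℕ.+ b) · Φ x)
    equal-ends = ≈-trans (∙-cong ≈-refl (·-congʳ b Φw≈Φx)) (·-distribʳ-+ (suc a) b (Φ x))

  convex-resp-≗ : ∀ {z w : Fin n → ℤ} → (∀ i → z i ≡ w i) → Φ z ≼ Φ w
  convex-resp-≗ {z} {w} z≗w = convex-≤-equal-ends 0 1 ≈-refl λ i →
    trans (cong (λ v → + 2 * v) (z≗w i)) (double (w i))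
    where
    double : ∀ v → + 2 * v ≡ + 1 * v + + 1 * v
    double = solve-∀

  convex-≤-equal-ends′ : ∀ {x w z : Fin n → ℤ} a → Φ w ≈ Φ x →
    (∀ i → + suc a * z i ≡ + a * x i + w i) → Φ z ≼ Φ x
  convex-≤-equal-ends′ {x} {w} {z} zero Φw≈Φx combination = ≤-respʳ-≈ Φw≈Φx (convex-resp-≗ λ i →
    trans (sym (ℤₚ.*-identityˡ (z i))) (trans (combination i) (ℤₚ.+-identityˡ (w i))))
  convex-≤-equal-ends′ {x} {w} {z} (suc a) Φw≈Φx combination = convex-≤-equal-ends a 1 Φw≈Φx λ i →
    trans (cong (λ k → + k * z i) (ℕₚ.+-comm (suc a) 1))
      (trans (combination i) (cong (_+_ (+ suc a * x i)) (sym (ℤₚ.*-identityˡ (w i)))))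

transpose-matchˡ : (s t : Fin n) → PC.transpose s t s ≡ t
transpose-matchˡ s t rewrite dec-true (s Finₚ.≟ s) refl = refl

transpose-matchʳ : (s t : Fin n) → PC.transpose s t t ≡ s
transpose-matchʳ s t with t Finₚ.≟ s
... | yes t≡s = t≡s
... | no  _   rewrite dec-true (t Finₚ.≟ t) refl = refl

transpose-noMatch : ∀ {s t i : Fin n} → i ≢ s → i ≢ t → PC.transpose s t i ≡ i
transpose-noMatch {s = s} {t} {i} i≢s i≢t
  rewrite dec-false (i Finₚ.≟ s) i≢s | dec-false (i Finₚ.≟ t) i≢t = refl

module _ {c ℓ ℓ′} (R : OrderedAbelianGroup c ℓ ℓ′) {n}
  {Φ : (Fin n → ℤ) → OrderedAbelianGroup.Carrier R}
  (symmetric : Symmetric R Φ) (convex : Convex R Φ) where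

  open OrderedAbelianGroup R using (isTotalOrder) renaming (_≤_ to _≼_; sym to ≈-sym)
  open IsTotalOrder isTotalOrder using () renaming (trans to ≼-trans)
  open Convexity R convex

  -- With y s − y t = a + 1, move y s t = (a·y + y∘(s t)) / (a + 1), and Φ (y∘(s t)) ≈ Φ y.
  levelling-≤ : ∀ {y : Fin n → ℤ} {s t} → y t < y s → Φ (move y s t) ≼ Φ y
  levelling-≤ {y} {s} {t} yt<ys with <⇒gap yt<ys
  ... | a , ys≡ = convex-≤-equal-ends′ a (≈-sym (symmetric (transpose s t) y)) combination
    where
    swapped : Fin _ → ℤ
    swapped = y ∘ (transpose s t ⟨$⟩ʳ_)
    s≢t : s ≢ t
    s≢t refl = ℤₚ.<-irrefl refl yt<ys
    at-s : + suc a * (y s - 1ℤ) ≡ + a * y s + y t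
    at-s rewrite ys≡ = identity (y t) (+ a)
      where
      identity : ∀ v a → (1ℤ + a) * (v + (1ℤ + a) - 1ℤ) ≡ a * (v + (1ℤ + a)) + v
      identity = solve-∀
    at-t : + suc a * (y t + 1ℤ) ≡ + a * y t + y s
    at-t rewrite ys≡ = identity (y t) (+ a)
      where
      identity : ∀ v a → (1ℤ + a) * (v + 1ℤ) ≡ a * v + (v + (1ℤ + a))
      identity = solve-∀
    elsewhere : ∀ v → + suc a * v ≡ + a * v + v
    elsewhere v = identity (+ a) v
      where
      identity : ∀ a v → (1ℤ + a) * v ≡ a * v + v
      identity = solve-∀
    combination : ∀ i → + suc a * move y s t i ≡ + a * y i + swapped i
    combination i = by-cases (i Finₚ.≟ s) (i Finₚ.≟ t)
      where
      by-cases : Dec (i ≡ s) → Dec (i ≡ t) → + suc a * move y s t i ≡ + a * y i + swapped i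
      by-cases (yes refl) _
        rewrite move-source y s≢t | transpose-matchˡ s t = at-s
      by-cases (no _) (yes refl)
        rewrite move-target y s≢t | transpose-matchʳ s t = at-t
      by-cases (no i≢s) (no i≢t)
        rewrite move-other y (i≢s ∘ sym) (i≢t ∘ sym) | transpose-noMatch i≢s i≢t = elsewhere (y i)

  decMin-≤ : ∀ {p : Subset n → ℤ₋∞} → Supermodular n p → ∀ {m} → DecMin p m →
    ∀ y → InB p y → Acc ℕ._<_ (ℓ₁ y m) → Φ m ≼ Φ y
  decMin-≤ supermodular {m} m-decMin y y∈B (acc closer) with Finₚ.any? (λ u → m u <? y u)
  ... | no ∄ =
    convex-resp-≗ (InB-≤⇒≗ (proj₁ m-decMin) y∈B λ i → ℤₚ.≮⇒≥ λ mi<yi → ∄ (i , mi<yi))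
  ... | yes above with ∃-argmax (λ u → m u <? y u) y above
  ...   | s , ms<ys , maximal with exchange supermodular y∈B (proj₁ m-decMin) ms<ys
  ...     | t , yt<mt , moved∈B = ≼-trans
    (decMin-≤ supermodular m-decMin (move y s t) moved∈B
      (closer (ℓ₁-move-< {y = y} {m} ms<ys yt<mt)))
    (levelling-≤ (decMin-exchange-gap supermodular m-decMin y∈B yt<mt maximal))

proposition6p3 : ∀ {c ℓ₁ ℓ₂} (R : OrderedAbelianGroup c ℓ₁ ℓ₂) (n : ℕ)
    (p : Subset n → ℤ₋∞) → Supermodular n p →
    (Φ : (Fin n → ℤ) → OrderedAbelianGroup.Carrier R) →
    Symmetric R Φ → Convex R Φ →
    ∀ m → DecMin p m → Minimizer R p Φ m
proposition6p3 R n p supermodular Φ symmetric convex m m-decMin =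
  proj₁ m-decMin , λ y y∈B →
    decMin-≤ R symmetric convex supermodular m-decMin y y∈B (<-wellFounded (ℓ₁ y m))
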